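{- For every covariant functor $F:\mathbf{Set}\to\mathbf{Set}$, the category $\mathbf{Gr}_F$ of $F$-graphs is complete and cocomplete.
   Context: An $F$-graph is a triple $(E,V,g)$ with sets $E$, $V$ and a map $g:E\to FV$. A homomorphism $\phi:(E_1,V_1,g_1)\to(E_2,V_2,g_2)$ is a pair of maps $\phi_E:E_1\to E_2$, $\phi_V:V_1\to V_2$ with $g_2\circ\phi_E=F(\phi_V)\circ g_1$. With componentwise composition these form the category $\mathbf{Gr}_F$. -}

module Defs where

open import Level using (Level; _⊔_) renaming (suc to lsuc)
open import Data.Product using (Σ; _×_; _,_)
open import Relation.Binary.Structures using (IsEquivalence)
open import Relation.Binary.Bundles using (Setoid)
open import Function.Bundles using (Func)

record Category (o ℓ e : Level) : Set (lsuc (o ⊔ ℓ ⊔ e)) where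
  infix  4 _≈_
  infixr 9 _∘_
  field
    Obj       : Set o
    _⇒_       : Obj → Obj → Set ℓ
    _≈_       : ∀ {A B} → (A ⇒ B) → (A ⇒ B) → Set e
    id        : ∀ {A} → A ⇒ A
    _∘_       : ∀ {A B C} → B ⇒ C → A ⇒ B → A ⇒ C
    equiv     : ∀ {A B} → IsEquivalence (_≈_ {A} {B})
    ∘-resp-≈  : ∀ {A B C} {f h : B ⇒ C} {g i : A ⇒ B} →
                f ≈ h → g ≈ i → f ∘ g ≈ h ∘ i
    assoc     : ∀ {A B C D} {f : A ⇒ B} {g : B ⇒ C} {h : C ⇒ D} →
                (h ∘ g) ∘ f ≈ h ∘ (g ∘ f)
    identityˡ : ∀ {A B} {f : A ⇒ B} → id ∘ f ≈ f
    identityʳ : ∀ {A B} {f : A ⇒ B} → f ∘ id ≈ f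

record Functor {o ℓ e o′ ℓ′ e′ : Level}
               (C : Category o ℓ e) (D : Category o′ ℓ′ e′)
               : Set (o ⊔ ℓ ⊔ e ⊔ o′ ⊔ ℓ′ ⊔ e′) where
  private
    module C = Category C
    module D = Category D
  field
    F₀           : C.Obj → D.Obj
    F₁           : ∀ {A B} → A C.⇒ B → F₀ A D.⇒ F₀ B
    identity     : ∀ {A} → F₁ (C.id {A}) D.≈ D.id
    homomorphism : ∀ {X Y Z} {f : X C.⇒ Y} {g : Y C.⇒ Z} →
                   F₁ (g C.∘ f) D.≈ F₁ g D.∘ F₁ f
    F-resp-≈     : ∀ {A B} {f g : A C.⇒ B} → f C.≈ g → F₁ f D.≈ F₁ g

module _ {o ℓ e o′ ℓ′ e′ : Level}
         {I : Category o′ ℓ′ e′} {C : Category o ℓ e}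
         (J : Functor I C) where
  private
    module I = Category I
    module C = Category C
    module J = Functor J
  open C using (_⇒_; _≈_; _∘_)

  record Cone : Set (o ⊔ ℓ ⊔ e ⊔ o′ ⊔ ℓ′) where
    field
      apex    : C.Obj
      ψ       : ∀ (j : I.Obj) → apex ⇒ J.F₀ j
      commute : ∀ {i j} (f : i I.⇒ j) → J.F₁ f ∘ ψ i ≈ ψ j

  record Cocone : Set (o ⊔ ℓ ⊔ e ⊔ o′ ⊔ ℓ′) where
    field
      coapex  : C.Obj
      ψ       : ∀ (j : I.Obj) → J.F₀ j ⇒ coapex
      commute : ∀ {i j} (f : i I.⇒ j) → ψ j ∘ J.F₁ f ≈ ψ i

  IsLimit : Cone → Set (o ⊔ ℓ ⊔ e ⊔ o′ ⊔ ℓ′)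
  IsLimit L = ∀ (K : Cone) →
    Σ (Cone.apex K ⇒ Cone.apex L) λ h →
      (∀ j → Cone.ψ L j ∘ h ≈ Cone.ψ K j) ×
      (∀ (h′ : Cone.apex K ⇒ Cone.apex L) →
         (∀ j → Cone.ψ L j ∘ h′ ≈ Cone.ψ K j) → h′ ≈ h)

  IsColimit : Cocone → Set (o ⊔ ℓ ⊔ e ⊔ o′ ⊔ ℓ′)
  IsColimit L = ∀ (K : Cocone) →
    Σ (Cocone.coapex L ⇒ Cocone.coapex K) λ h →
      (∀ j → h ∘ Cocone.ψ L j ≈ Cocone.ψ K j) ×
      (∀ (h′ : Cocone.coapex L ⇒ Cocone.coapex K) →
         (∀ j → h′ ∘ Cocone.ψ L j ≈ Cocone.ψ K j) → h′ ≈ h)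

  Limit : Set (o ⊔ ℓ ⊔ e ⊔ o′ ⊔ ℓ′)
  Limit = Σ Cone IsLimit

  Colimit : Set (o ⊔ ℓ ⊔ e ⊔ o′ ⊔ ℓ′)
  Colimit = Σ Cocone IsColimit

Complete : ∀ {o ℓ e} (o′ ℓ′ e′ : Level) → Category o ℓ e →
           Set (o ⊔ ℓ ⊔ e ⊔ lsuc (o′ ⊔ ℓ′ ⊔ e′))
Complete o′ ℓ′ e′ C = ∀ (I : Category o′ ℓ′ e′) (J : Functor I C) → Limit J

Cocomplete : ∀ {o ℓ e} (o′ ℓ′ e′ : Level) → Category o ℓ e →
             Set (o ⊔ ℓ ⊔ e ⊔ lsuc (o′ ⊔ ℓ′ ⊔ e′))
Cocomplete o′ ℓ′ e′ C = ∀ (I : Category o′ ℓ′ e′) (J : Functor I C) → Colimit J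

-- The category Set, modelled (constructively) as setoids and
-- equality-preserving maps, compared pointwise.

Setoids : (ℓ : Level) → Category (lsuc ℓ) ℓ ℓ
Setoids ℓ = record
  { Obj       = Setoid ℓ ℓ
  ; _⇒_       = Func
  ; _≈_       = λ {A} {B} f g → ∀ x → Setoid._≈_ B (Func.to f x) (Func.to g x)
  ; id        = λ {A} → record { to = λ x → x ; cong = λ p → p }
  ; _∘_       = λ g f → record { to = λ x → Func.to g (Func.to f x)
                               ; cong = λ p → Func.cong g (Func.cong f p) }
  ; equiv     = λ {A} {B} → record
      { refl  = λ x → Setoid.refl B
      ; sym   = λ p x → Setoid.sym B (p x)
      ; trans = λ p q x → Setoid.trans B (p x) (q x) }
  ; ∘-resp-≈  = λ {A} {B} {C} {f} {h} {g} {i} p q x →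
                  Setoid.trans C (Func.cong f (q x)) (p (Func.to i x))
  ; assoc     = λ {A} {B} {C} {D} x → Setoid.refl D
  ; identityˡ = λ {A} {B} x → Setoid.refl B
  ; identityʳ = λ {A} {B} x → Setoid.refl B
  }

module _ {ℓ : Level} (F : Functor (Setoids ℓ) (Setoids ℓ)) where
  private
    module F = Functor F
    module S = Category (Setoids ℓ)

  record FGraph : Set (lsuc ℓ) where
    field
      E : Setoid ℓ ℓ
      V : Setoid ℓ ℓ
      g : Func E (F.F₀ V)

  record FGraphHom (G₁ G₂ : FGraph) : Set ℓ where
    private
      module G₁ = FGraph G₁
      module G₂ = FGraph G₂
    field
      φE      : Func G₁.E G₂.E
      φV      : Func G₁.V G₂.V
      commute : (G₂.g S.∘ φE) S.≈ (F.F₁ φV S.∘ G₁.g)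

  open FGraphHom

  private
    idH : ∀ {G : FGraph} → FGraphHom G G
    idH {G} = record
      { φE = S.id ; φV = S.id
      ; commute = λ x → Setoid.sym (F.F₀ (FGraph.V G))
                          (F.identity (Func.to (FGraph.g G) x)) }

    compH : ∀ {A B C} → FGraphHom B C → FGraphHom A B → FGraphHom A C
    compH {A} {B} {C} ψ φ = record
      { φE = φE ψ S.∘ φE φ
      ; φV = φV ψ S.∘ φV φ
      ; commute = λ x →
          let open Setoid (F.F₀ (FGraph.V C)) in
          trans (commute ψ (Func.to (φE φ) x))
            (trans (Func.cong (F.F₁ (φV ψ)) (commute φ x))
                   (sym (F.homomorphism {f = φV φ} {g = φV ψ}
                          (Func.to (FGraph.g A) x))))
      }

  Gr : Category (lsuc ℓ) ℓ ℓ
  Gr = record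
    { Obj       = FGraph
    ; _⇒_       = FGraphHom
    ; _≈_       = λ φ ψ → (φE φ S.≈ φE ψ) × (φV φ S.≈ φV ψ)
    ; id        = idH
    ; _∘_       = compH
    ; equiv     = λ {A} {B} → record
        { refl  = (λ x → Setoid.refl (FGraph.E B)) , (λ x → Setoid.refl (FGraph.V B))
        ; sym   = λ { (p , q) → (λ x → Setoid.sym (FGraph.E B) (p x))
                              , (λ x → Setoid.sym (FGraph.V B) (q x)) }
        ; trans = λ { (p , q) (p′ , q′) → (λ x → Setoid.trans (FGraph.E B) (p x) (p′ x))
                                        , (λ x → Setoid.trans (FGraph.V B) (q x) (q′ x)) } }
    ; ∘-resp-≈  = λ { {f = f} {h} {g} {i} (p , q) (p′ , q′) →
                      S.∘-resp-≈ {f = φE f} {φE h} {φE g} {φE i} p p′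
                    , S.∘-resp-≈ {f = φV f} {φV h} {φV g} {φV i} q q′ }
    ; assoc     = λ {A} {B} {C} {D} → (λ x → Setoid.refl (FGraph.E D)) , (λ x → Setoid.refl (FGraph.V D))
    ; identityˡ = λ {A} {B} → (λ x → Setoid.refl (FGraph.E B)) , (λ x → Setoid.refl (FGraph.V B))
    ; identityʳ = λ {A} {B} → (λ x → Setoid.refl (FGraph.E B)) , (λ x → Setoid.refl (FGraph.V B))
    }

-- Limits and colimits of F-graphs are computed from those of setoids.
-- Colimits are taken componentwise: the labelling of the colimit of the
-- edge setoids is induced by the maps E_j → F V_j → F (colim V), which
-- are compatible because the maps of the diagram are homomorphisms.  Limits are componentwise
-- on vertices, but F need not preserve limits, so an edge of the limit
-- is a compatible family of edges e_j together with one label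
-- t ∈ F (lim V) whose images F(π_j) t are the labels g_j e_j; i.e. the
-- edge setoid is the pullback of lim E → Π_j F V_j ← F (lim V).
module Submission where

open import Defs
open import Level using (Level)
open import Data.Product using (Σ; _×_; _,_; proj₁; proj₂)
open import Data.Product.Relation.Binary.Pointwise.NonDependent using (×-setoid)
open import Relation.Binary.Core using (Rel)
open import Relation.Binary.Bundles using (Setoid)
import Relation.Binary.Construct.On as On
open import Relation.Binary.Construct.Closure.Equivalence as EqClosure
  using (EqClosure)
open import Relation.Binary.Construct.Closure.ReflexiveTransitive using (return)
open import Relation.Binary.Construct.Closure.Symmetric using (fwd; bwd)
import Relation.Binary.Reasoning.Setoid as SetoidReasoning
open import Function.Bundles using (Func)

open Func

module SetoidLimit {ℓ e : Level} {I : Category ℓ ℓ e}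
                   (D : Category.Obj I → Setoid ℓ ℓ)
                   (m : ∀ {i j} → Category._⇒_ I i j → Func (D i) (D j)) where
  private
    module I = Category I
    module D j = Setoid (D j)

  Compatible : (∀ j → D.Carrier j) → Set ℓ
  Compatible x = ∀ {i j} (f : i I.⇒ j) → D._≈_ j (to (m f) (x i)) (x j)

  Lim : Setoid ℓ ℓ
  Lim = record
    { Carrier       = Σ (∀ j → D.Carrier j) Compatible
    ; _≈_           = λ x y → ∀ j → D._≈_ j (proj₁ x j) (proj₁ y j)
    ; isEquivalence = record
      { refl  = λ j → D.refl j
      ; sym   = λ p j → D.sym j (p j)
      ; trans = λ p q j → D.trans j (p j) (q j) } }

  π : ∀ j → Func Lim (D j)
  π j = record { to = λ x → proj₁ x j ; cong = λ p → p j }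

  tuple : (W : Setoid ℓ ℓ) (k : ∀ j → Func W (D j)) →
          (∀ {i j} (f : i I.⇒ j) w → D._≈_ j (to (m f) (to (k i) w)) (to (k j) w)) →
          Func W Lim
  tuple W k k-compatible = record
    { to   = λ w → (λ j → to (k j) w) , λ f → k-compatible f w
    ; cong = λ p j → cong (k j) p }

module SetoidColimit {ℓ e : Level} {I : Category ℓ ℓ e}
                     (D : Category.Obj I → Setoid ℓ ℓ)
                     (m : ∀ {i j} → Category._⇒_ I i j → Func (D i) (D j)) where
  private
    module I = Category I
    module D j = Setoid (D j)

  Point : Set ℓ
  Point = Σ I.Obj D.Carrier

  data Glue : Rel Point ℓ where
    within : ∀ {j x y} → D._≈_ j x y → Glue (j , x) (j , y)
    along  : ∀ {i j} (f : i I.⇒ j) x → Glue (i , x) (j , to (m f) x)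

  Colim : Setoid ℓ ℓ
  Colim = EqClosure.setoid Glue

  ι : ∀ j → Func (D j) Colim
  ι j = record { to = λ x → j , x ; cong = λ p → return (fwd (within p)) }

  ι-commute : ∀ {i j} (f : i I.⇒ j) x →
              Setoid._≈_ Colim (to (ι j) (to (m f) x)) (to (ι i) x)
  ι-commute f x = return (bwd (along f x))

  cotuple : (W : Setoid ℓ ℓ) (k : ∀ j → Func (D j) W) →
            (∀ {i j} (f : i I.⇒ j) x → Setoid._≈_ W (to (k j) (to (m f) x)) (to (k i) x)) →
            Func Colim W
  cotuple W k k-compatible = record
    { to   = at
    ; cong = EqClosure.gfold (Setoid.isEquivalence W) at respects-glue }
    where
    at : Point → Setoid.Carrier W
    at (j , x) = to (k j) x

    respects-glue : ∀ {a b} → Glue a b → Setoid._≈_ W (at a) (at b)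
    respects-glue (within {j} p) = cong (k j) p
    respects-glue (along f x)    = Setoid.sym W (k-compatible f x)

module GrDiagram {ℓ e : Level} (F : Functor (Setoids ℓ) (Setoids ℓ))
                 {I : Category ℓ ℓ e} (J : Functor I (Gr F)) where
  private
    module F = Functor F
    module S = Category (Setoids ℓ)
    module Gr = Category (Gr F)
    module I = Category I
    module J = Functor J
  open FGraph
  open FGraphHom

  Eᵢ Vᵢ : I.Obj → Setoid ℓ ℓ
  Eᵢ j = E (J.F₀ j)
  Vᵢ j = V (J.F₀ j)

  module LimE = SetoidLimit {I = I} Eᵢ (λ f → φE (J.F₁ f))
  module LimV = SetoidLimit {I = I} Vᵢ (λ f → φV (J.F₁ f))
  module ColimE = SetoidColimit {I = I} Eᵢ (λ f → φE (J.F₁ f))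
  module ColimV = SetoidColimit {I = I} Vᵢ (λ f → φV (J.F₁ f))

  LabelOver : Setoid.Carrier LimE.Lim × Setoid.Carrier (F.F₀ LimV.Lim) → Set ℓ
  LabelOver (x , t) = ∀ j → Setoid._≈_ (F.F₀ (Vᵢ j))
                              (to (F.F₁ (LimV.π j)) t) (to (g (J.F₀ j)) (proj₁ x j))

  limitGraph : FGraph F
  limitGraph = record
    { E = On.setoid (×-setoid LimE.Lim (F.F₀ LimV.Lim)) (proj₁ {B = LabelOver})
    ; V = LimV.Lim
    ; g = record { to = λ x → proj₂ (proj₁ x) ; cong = proj₂ } }

  limitCone : Cone J
  limitCone = record
    { apex    = limitGraph
    ; ψ       = λ j → record
      { φE      = record { to = λ x → proj₁ (proj₁ (proj₁ x)) j ; cong = λ p → proj₁ p j }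
      ; φV      = LimV.π j
      ; commute = λ x → Setoid.sym (F.F₀ (Vᵢ j)) (proj₂ x j) }
    ; commute = λ f → (λ x → proj₂ (proj₁ (proj₁ x)) f) , (λ x → proj₂ x f) }

  limitCone-isLimit : IsLimit J limitCone
  limitCone-isLimit K = h , (λ j → (λ _ → Setoid.refl (Eᵢ j)) , (λ _ → Setoid.refl (Vᵢ j))) , unique
    where
    module K = Cone K
    A = K.apex

    hV : Func (V A) LimV.Lim
    hV = LimV.tuple (V A) (λ j → φV (K.ψ j)) (λ f → proj₂ (K.commute f))

    hE : Func (E A) LimE.Lim
    hE = LimE.tuple (E A) (λ j → φE (K.ψ j)) (λ f → proj₁ (K.commute f))

    hE-labelled : ∀ x → LabelOver (to hE x , to (F.F₁ hV) (to (g A) x))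
    hE-labelled x j = begin
        to (F.F₁ (LimV.π j)) (to (F.F₁ hV) (to (g A) x))
      ≈⟨ F.homomorphism {f = hV} {g = LimV.π j} (to (g A) x) ⟨
        to (F.F₁ (φV (K.ψ j))) (to (g A) x)
      ≈⟨ commute (K.ψ j) x ⟨
        to (g (J.F₀ j)) (to (φE (K.ψ j)) x)
      ∎
      where open SetoidReasoning (F.F₀ (Vᵢ j))

    h : FGraphHom F A limitGraph
    h = record
      { φE      = record
        { to   = λ x → (to hE x , to (F.F₁ hV) (to (g A) x)) , hE-labelled x
        ; cong = λ p → cong hE p , cong (F.F₁ hV) (cong (g A) p) }
      ; φV      = hV
      ; commute = λ _ → Setoid.refl (F.F₀ LimV.Lim) }

    -- The label of h′ x is forced: h′ is a homomorphism, so it is F(φV h′) (g x).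
    unique : ∀ h′ → (∀ j → Cone.ψ limitCone j Gr.∘ h′ Gr.≈ K.ψ j) → h′ Gr.≈ h
    unique h′ eq =
        (λ x → (λ j → proj₁ (eq j) x)
             , Setoid.trans (F.F₀ LimV.Lim) (commute h′ x)
                 (F.F-resp-≈ {f = φV h′} {g = hV} (λ v j → proj₂ (eq j) v) (to (g A) x)))
      , (λ v j → proj₂ (eq j) v)

  colimitLabel : Func ColimE.Colim (F.F₀ ColimV.Colim)
  colimitLabel = ColimE.cotuple (F.F₀ ColimV.Colim)
    (λ j → F.F₁ (ColimV.ι j) S.∘ g (J.F₀ j)) label-compatible
    where
    label-compatible : ∀ {i j} (f : i I.⇒ j) x →
      Setoid._≈_ (F.F₀ ColimV.Colim)
        (to (F.F₁ (ColimV.ι j)) (to (g (J.F₀ j)) (to (φE (J.F₁ f)) x)))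
        (to (F.F₁ (ColimV.ι i)) (to (g (J.F₀ i)) x))
    label-compatible {i} {j} f x = begin
        to (F.F₁ (ColimV.ι j)) (to (g (J.F₀ j)) (to (φE (J.F₁ f)) x))
      ≈⟨ cong (F.F₁ (ColimV.ι j)) (commute (J.F₁ f) x) ⟩
        to (F.F₁ (ColimV.ι j)) (to (F.F₁ (φV (J.F₁ f))) (to (g (J.F₀ i)) x))
      ≈⟨ F.homomorphism {f = φV (J.F₁ f)} {g = ColimV.ι j} (to (g (J.F₀ i)) x) ⟨
        to (F.F₁ (ColimV.ι j S.∘ φV (J.F₁ f))) (to (g (J.F₀ i)) x)
      ≈⟨ F.F-resp-≈ {f = ColimV.ι j S.∘ φV (J.F₁ f)} {g = ColimV.ι i}
                    (ColimV.ι-commute f) (to (g (J.F₀ i)) x) ⟩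
        to (F.F₁ (ColimV.ι i)) (to (g (J.F₀ i)) x)
      ∎
      where open SetoidReasoning (F.F₀ ColimV.Colim)

  colimitGraph : FGraph F
  colimitGraph = record { E = ColimE.Colim ; V = ColimV.Colim ; g = colimitLabel }

  colimitCocone : Cocone J
  colimitCocone = record
    { coapex  = colimitGraph
    ; ψ       = λ j → record
      { φE = ColimE.ι j ; φV = ColimV.ι j ; commute = λ _ → Setoid.refl (F.F₀ ColimV.Colim) }
    ; commute = λ f → ColimE.ι-commute f , ColimV.ι-commute f }

  colimitCocone-isColimit : IsColimit J colimitCocone
  colimitCocone-isColimit K = h , (λ j → (λ _ → Setoid.refl (E B)) , (λ _ → Setoid.refl (V B))) , unique
    where
    module K = Cocone K
    B = K.coapex

    hV : Func ColimV.Colim (V B)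
    hV = ColimV.cotuple (V B) (λ j → φV (K.ψ j)) (λ f → proj₂ (K.commute f))

    hE-commute : ∀ x → Setoid._≈_ (F.F₀ (V B))
                   (to (g B) (to (φE (K.ψ (proj₁ x))) (proj₂ x)))
                   (to (F.F₁ hV) (to colimitLabel x))
    hE-commute (j , x) = begin
        to (g B) (to (φE (K.ψ j)) x)
      ≈⟨ commute (K.ψ j) x ⟩
        to (F.F₁ (φV (K.ψ j))) (to (g (J.F₀ j)) x)
      ≈⟨ F.F-resp-≈ {f = φV (K.ψ j)} {g = hV S.∘ ColimV.ι j}
                    (λ _ → Setoid.refl (V B)) (to (g (J.F₀ j)) x) ⟩
        to (F.F₁ (hV S.∘ ColimV.ι j)) (to (g (J.F₀ j)) x)
      ≈⟨ F.homomorphism {f = ColimV.ι j} {g = hV} (to (g (J.F₀ j)) x) ⟩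
        to (F.F₁ hV) (to (F.F₁ (ColimV.ι j)) (to (g (J.F₀ j)) x))
      ∎
      where open SetoidReasoning (F.F₀ (V B))

    h : FGraphHom F colimitGraph B
    h = record
      { φE      = ColimE.cotuple (E B) (λ j → φE (K.ψ j)) (λ f → proj₁ (K.commute f))
      ; φV      = hV
      ; commute = hE-commute }

    unique : ∀ h′ → (∀ j → h′ Gr.∘ Cocone.ψ colimitCocone j Gr.≈ K.ψ j) → h′ Gr.≈ h
    unique h′ eq = (λ { (j , x) → proj₁ (eq j) x }) , (λ { (j , v) → proj₂ (eq j) v })

theorem4p10 : ∀ {ℓ : Level} (F : Functor (Setoids ℓ) (Setoids ℓ)) →
    Complete ℓ ℓ ℓ (Gr F) × Cocomplete ℓ ℓ ℓ (Gr F)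
theorem4p10 F =
    (λ I J → let open GrDiagram F J in limitCone , limitCone-isLimit)
  , (λ I J → let open GrDiagram F J in colimitCocone , colimitCocone-isColimit)
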